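{- For any positive integers $m,R,\delta$, the map $\phi : V(U(m,R,\delta)) \rightarrow V(U(m,R,\delta-1))$ given by $\phi(\langle \alpha, A_1, \ldots, A_{\delta} \rangle) = \langle \alpha, A_1, \ldots, A_{\delta-1} \rangle$ is a complete graph homomorphism $U(m,R,\delta)\to U(m,R,\delta-1)$.
   Context: A chain of length $f$ and size $s$ in $[m]$ is a nested sequence $A_0\subseteq\cdots\subseteq A_f\subseteq[m]$ with $|A_0|=1$, $|A_f|=s$, written $\langle\alpha,A_1,\dots,A_f\rangle$ where $A_0=\{\alpha\}$. The graph $U(m,R,\delta)$ has as vertices all chains in $[m]$ of length $\delta$ and size at most $R$, and $\langle\alpha,A_1,\dots,A_\delta\rangle$, $\langle\beta,B_1,\dots,B_\delta\rangle$ are adjacent iff $\alpha\neq\beta$, $\alpha\in B_1$, $\beta\in A_1$, and $A_i\subseteq B_{i+1}$, $B_i\subseteq A_{i+1}$ for all $1\le i\le\delta-1$. (For $\delta=0$ the vertices are the chains $\langle\alpha\rangle$ and any two distinct ones are adjacent.) A graph homomorphism $\phi:H\to G$ is complete if for any $x,z\in V(H)$ with $\phi(z)\in\phi(N(x))$ and $\phi(x)\in\phi(N(z))$ we have $(x,z)\in E(H)$, where $N(\cdot)$ is the neighbourhood and $\phi(X)=\{\phi(x):x\in X\}$. -}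

module Defs where

open import Data.Nat using (ℕ; zero; suc; _≤_)
open import Data.Nat.Properties using (≤-trans)
open import Data.Fin using (Fin; inject₁) renaming (suc to fsuc)
open import Data.Fin.Subset using (Subset; _⊆_; _∈_; ⁅_⁆; ∣_∣)
open import Data.Fin.Subset.Properties using (p⊆q⇒∣p∣≤∣q∣)
open import Data.Vec using (Vec; []; _∷_; lookup)
open import Data.Product using (Σ; _×_; _,_; proj₁; proj₂)
open import Data.Unit using (⊤; tt)
open import Relation.Binary.PropositionalEquality using (_≡_)
open import Relation.Nullary using (¬_)

Nested : ∀ {m f} → Subset m → Vec (Subset m) f → Set
Nested X []       = ⊤
Nested X (A ∷ As) = (X ⊆ A) × Nested A As

top : ∀ {m f} → Subset m → Vec (Subset m) f → Subset m
top X []       = X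
top X (A ∷ As) = top A As

record Chain (m R f : ℕ) : Set where
  constructor chain
  field
    α      : Fin m
    sets   : Vec (Subset m) f
    nested : Nested ⁅ α ⁆ sets
    small  : ∣ top ⁅ α ⁆ sets ∣ ≤ R
open Chain public

V[U] : ℕ → ℕ → ℕ → Set
V[U] m R δ = Chain m R δ

-- Equality of chains as mathematical objects (same α and same sets)
_≈C_ : ∀ {m R f} → Chain m R f → Chain m R f → Set
x ≈C y = (α x ≡ α y) × (sets x ≡ sets y)

-- Adjacency in U(m,R,δ)
-- (for δ ≥ 1, with A = A₁ ∷ …, index i : Fin δ standing for A_{i+1})
Adj : ∀ {m R δ} → Chain m R δ → Chain m R δ → Set
Adj {δ = zero}  x y = ¬ (α x ≡ α y)
Adj {δ = suc d} x y =
  (¬ (α x ≡ α y)) ×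
  (α x ∈ lookup (sets y) Fin.zero) ×
  (α y ∈ lookup (sets x) Fin.zero) ×
  ((i : Fin d) → lookup (sets x) (inject₁ i) ⊆ lookup (sets y) (fsuc i)) ×
  ((i : Fin d) → lookup (sets y) (inject₁ i) ⊆ lookup (sets x) (fsuc i))
  where import Data.Fin as Fin

IsHom : ∀ {V W : Set} → (V → V → Set) → (W → W → Set) → (V → W) → Set
IsHom {V} E F φ = (x y : V) → E x y → F (φ x) (φ y)

InImageNbhd : ∀ {V W : Set} → (V → V → Set) → (W → W → Set) → (V → W) → V → W → Set
InImageNbhd {V} E _≈_ φ x w = Σ V λ y → E x y × (φ y ≈ w)

IsComplete : ∀ {V W : Set} → (V → V → Set) → (W → W → Set) → (W → W → Set) → (V → W) → Set
IsComplete {V} E F _≈_ φ =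
  IsHom E F φ ×
  ((x z : V) → InImageNbhd E _≈_ φ x (φ z) → InImageNbhd E _≈_ φ z (φ x) → E x z)

dropLast : ∀ {A : Set} {n} → Vec A (suc n) → Vec A n
dropLast (x ∷ [])     = []
dropLast (x ∷ y ∷ ys) = x ∷ dropLast (y ∷ ys)

nested-drop : ∀ {m n} (X : Subset m) (As : Vec (Subset m) (suc n)) →
              Nested X As → Nested X (dropLast As)
nested-drop X (A ∷ [])     _        = tt
nested-drop X (A ∷ B ∷ Bs) (p , q)  = p , nested-drop A (B ∷ Bs) q

top-drop : ∀ {m n} (X : Subset m) (As : Vec (Subset m) (suc n)) →
           Nested X As → top X (dropLast As) ⊆ top X As
top-drop X (A ∷ [])     (p , _) = p
top-drop X (A ∷ B ∷ Bs) (_ , q) = top-drop A (B ∷ Bs) q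

φ : ∀ {m R d} → Chain m R (suc d) → Chain m R d
φ (chain a As nst sm) =
  chain a (dropLast As) (nested-drop ⁅ a ⁆ As nst)
        (≤-trans (p⊆q⇒∣p∣≤∣q∣ (top-drop ⁅ a ⁆ As nst)) sm)

-- Adjacency of x and z in U(m,R,δ) splits into α x ≠ α z and the two
-- symmetric conditions "x ↝ z": α x ∈ Z₁ and X_i ⊆ Z_{i+1} for i < δ.
-- The condition x ↝ z only reads X₁, …, X_{δ-1}, i.e. it depends on x only
-- through φ x.  So if x has a neighbour y with φ y = φ z, then z ↝ x because
-- y ↝ x, and symmetrically x ↝ z; together with α x ≠ α y = α z this makes
-- x and z adjacent.
module Submission where

open import Defs
open import Data.Nat using (ℕ; suc; zero; _≤_)
open import Data.Fin using (Fin; inject₁) renaming (zero to fzero; suc to fsuc)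
open import Data.Fin.Subset using (_⊆_; _∈_)
open import Data.Vec using (Vec; _∷_; lookup)
open import Data.Product using (_×_; _,_; proj₁; proj₂)
open import Relation.Binary.PropositionalEquality
  using (_≡_; _≢_; refl; sym; trans; cong; subst; subst₂; module ≡-Reasoning)

lookup-dropLast : ∀ {A : Set} {n} (xs : Vec A (suc n)) (i : Fin n) →
                  lookup (dropLast xs) i ≡ lookup xs (inject₁ i)
lookup-dropLast (x ∷ y ∷ ys) fzero    = refl
lookup-dropLast (x ∷ y ∷ ys) (fsuc i) = lookup-dropLast (y ∷ ys) i

dropLast-≡⇒lookup-inject₁-≡ : ∀ {A : Set} {n} (xs ys : Vec A (suc n)) →
                              dropLast xs ≡ dropLast ys →
                              (i : Fin n) → lookup xs (inject₁ i) ≡ lookup ys (inject₁ i)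
dropLast-≡⇒lookup-inject₁-≡ xs ys eq i = begin
  lookup xs (inject₁ i)          ≡⟨ sym (lookup-dropLast xs i) ⟩
  lookup (dropLast xs) i         ≡⟨ cong (λ v → lookup v i) eq ⟩
  lookup (dropLast ys) i         ≡⟨ lookup-dropLast ys i ⟩
  lookup ys (inject₁ i)          ∎
  where open ≡-Reasoning

module _ {m R : ℕ} where

  infix 4 _↝_

  record _↝_ {d} (x z : Chain m R (suc d)) : Set where
    constructor reaches
    field
      α∈first   : α x ∈ lookup (sets z) fzero
      ⊆shifted : (i : Fin d) → lookup (sets x) (inject₁ i) ⊆ lookup (sets z) (fsuc i)

  Adj⇒≢ : ∀ {d} (x z : Chain m R d) → Adj x z → α x ≢ α z
  Adj⇒≢ {zero}  x z ne       = ne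
  Adj⇒≢ {suc d} x z (ne , _) = ne

  Adj⇒↝ : ∀ {d} (x z : Chain m R (suc d)) → Adj x z → x ↝ z × z ↝ x
  Adj⇒↝ x z (_ , x∈Z₁ , z∈X₁ , X⊆Z , Z⊆X) = reaches x∈Z₁ X⊆Z , reaches z∈X₁ Z⊆X

  ↝⇒Adj : ∀ {d} {x z : Chain m R (suc d)} →
          α x ≢ α z → x ↝ z → z ↝ x → Adj x z
  ↝⇒Adj ne (reaches x∈Z₁ X⊆Z) (reaches z∈X₁ Z⊆X) = ne , x∈Z₁ , z∈X₁ , X⊆Z , Z⊆X

  ↝-respects-φ : ∀ {d} {x x′ z : Chain m R (suc d)} →
                 φ x ≈C φ x′ → x ↝ z → x′ ↝ z
  ↝-respects-φ {x = x} {x′} {z} (α≡ , sets≡) (reaches x∈Z₁ X⊆Z) =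
    reaches (subst (_∈ lookup (sets z) fzero) α≡ x∈Z₁)
    (λ i → subst (_⊆ lookup (sets z) (fsuc i))
                 (dropLast-≡⇒lookup-inject₁-≡ (sets x) (sets x′) sets≡ i) (X⊆Z i))

  φ-preserves-↝ : ∀ {d} {x z : Chain m R (suc (suc d))} → x ↝ z → φ x ↝ φ z
  φ-preserves-↝ {x = x} {z} (reaches x∈Z₁ X⊆Z) =
    reaches (subst (α x ∈_) (sym (lookup-dropLast (sets z) fzero)) x∈Z₁)
    (λ i → subst₂ _⊆_ (sym (lookup-dropLast (sets x) (inject₁ i)))
                      (sym (lookup-dropLast (sets z) (fsuc i)))
                      (X⊆Z (inject₁ i)))

  φ-isHom : ∀ d → IsHom (Adj {m} {R} {suc d}) (Adj {m} {R} {d}) φ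
  φ-isHom zero    x z adj = Adj⇒≢ x z adj
  φ-isHom (suc d) x z adj with Adj⇒↝ x z adj
  ... | x↝z , z↝x = ↝⇒Adj (Adj⇒≢ x z adj) (φ-preserves-↝ x↝z) (φ-preserves-↝ z↝x)

  φ-reflects-Adj : ∀ d (x z : Chain m R (suc d)) →
                   InImageNbhd Adj _≈C_ φ x (φ z) →
                   InImageNbhd Adj _≈C_ φ z (φ x) →
                   Adj x z
  φ-reflects-Adj d x z (y , x~y , φy≈φz) (w , z~w , φw≈φx) =
    ↝⇒Adj x≢z (↝-respects-φ φw≈φx w↝z) (↝-respects-φ φy≈φz y↝x)
    where
    y↝x : y ↝ x
    y↝x = proj₂ (Adj⇒↝ x y x~y)
    w↝z : w ↝ z
    w↝z = proj₂ (Adj⇒↝ z w z~w)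
    x≢z : α x ≢ α z
    x≢z αx≡αz = Adj⇒≢ x y x~y (trans αx≡αz (sym (proj₁ φy≈φz)))

lemma2p9 : (m R d : ℕ) → 1 ≤ m → 1 ≤ R →
    IsComplete (Adj {m} {R} {suc d}) (Adj {m} {R} {d}) (_≈C_ {m} {R} {d}) (φ {m} {R} {d})
lemma2p9 m R d _ _ = φ-isHom d , φ-reflects-Adj d
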